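{- There exist infinitely many pairwise non-isomorphic $2$-edge-colored graphs $G$ that are $2$-$\mathcal{NM}$-closed, color-connected, and have an alternating cycle factor, but have no alternating Hamiltonian cycle.
   Context: Edges are colored blue or red. A path or cycle is alternating if no two consecutive edges have the same color; it is Hamiltonian if it visits every vertex. An alternating cycle factor is a collection of pairwise vertex-disjoint alternating cycles covering all vertices. $G$ is color-connected if for every pair of distinct vertices $x,y$ there exist alternating $(x,y)$-paths $P$ and $Q$ whose first edges have different colors and whose last edges have different colors. $G$ is $2$-$\mathcal{NM}$-closed if for every non-monochromatic $2$-path $(x_1,x_2,x_3)$ (the two edges having different colors) there exists an edge between $x_1$ and $x_3$. -}

module Defs where

open import Data.Nat using (ℕ; zero; suc; _<_; _≤_; _∸_)
open import Data.Fin using (Fin)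
open import Data.Bool using (Bool; true; false)
open import Data.Product using (Σ; ∃; ∃-syntax; _×_; _,_)
open import Relation.Binary.PropositionalEquality using (_≡_; _≢_)
open import Relation.Nullary using (¬_)
open import Function.Bundles using (_↔_; Inverse)

data Color : Set where
  blue red : Color

-- A finite 2-edge-coloured multigraph on vertex set Fin n (no loops).
-- Between two vertices there may be a blue edge, a red edge, both, or none.
record Graph2 : Set where
  field
    n      : ℕ
    edge   : Color → Fin n → Fin n → Bool
    sym    : ∀ c x y → edge c x y ≡ edge c y x
    irrefl : ∀ c x → edge c x x ≡ false
open Graph2 public

E : (G : Graph2) → Color → Fin (n G) → Fin (n G) → Set
E G c x y = edge G c x y ≡ true

record AltPath (G : Graph2) (x y : Fin (n G)) : Set where
  field
    len     : ℕ
    len≥1   : 1 ≤ len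
    v       : ℕ → Fin (n G)
    col     : ℕ → Color
    start   : v 0 ≡ x
    end     : v len ≡ y
    edges   : ∀ i → i < len → E G (col i) (v i) (v (suc i))
    alt     : ∀ i → suc i < len → col i ≢ col (suc i)
    distinct : ∀ i j → i ≤ len → j ≤ len → v i ≡ v j → i ≡ j

firstColor : ∀ {G x y} → AltPath G x y → Color
firstColor P = AltPath.col P 0

lastColor : ∀ {G x y} → AltPath G x y → Color
lastColor P = AltPath.col P (AltPath.len P ∸ 1)

record AltCycle (G : Graph2) : Set where
  field
    len      : ℕ
    len≥2    : 2 ≤ len
    v        : ℕ → Fin (n G)
    col      : ℕ → Color
    closed   : v len ≡ v 0
    edges    : ∀ i → i < len → E G (col i) (v i) (v (suc i))
    alt      : ∀ i → suc i < len → col i ≢ col (suc i)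
    altClose : col (len ∸ 1) ≢ col 0
    distinct : ∀ i j → i < len → j < len → v i ≡ v j → i ≡ j

OnCycle : ∀ {G} → AltCycle G → Fin (n G) → Set
OnCycle C w = ∃[ i ] (i < AltCycle.len C × AltCycle.v C i ≡ w)

IsHamiltonian : ∀ {G} → AltCycle G → Set
IsHamiltonian {G} C = ∀ (w : Fin (n G)) → OnCycle C w

HasAltHamCycle : Graph2 → Set
HasAltHamCycle G = Σ (AltCycle G) IsHamiltonian

HasAltCycleFactor : Graph2 → Set
HasAltCycleFactor G =
  Σ ℕ λ m → Σ (Fin m → AltCycle G) λ C →
    (∀ a b (w : Fin (n G)) → OnCycle (C a) w → OnCycle (C b) w → a ≡ b)
    × (∀ (w : Fin (n G)) → ∃[ a ] OnCycle (C a) w)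

ColorConnected : Graph2 → Set
ColorConnected G = ∀ (x y : Fin (n G)) → x ≢ y →
  Σ (AltPath G x y) λ P → Σ (AltPath G x y) λ Q →
    firstColor P ≢ firstColor Q × lastColor P ≢ lastColor Q

TwoNMClosed : Graph2 → Set
TwoNMClosed G = ∀ (x₁ x₂ x₃ : Fin (n G)) (c₁ c₂ : Color) →
  x₁ ≢ x₃ → E G c₁ x₁ x₂ → E G c₂ x₂ x₃ → c₁ ≢ c₂ →
  ∃[ c ] E G c x₁ x₃

Isomorphic : Graph2 → Graph2 → Set
Isomorphic G H = Σ (Fin (n G) ↔ Fin (n H)) λ f →
  ∀ c x y → edge G c x y ≡ edge H c (Inverse.to f x) (Inverse.to f y)

module Submission where

-- The examples are "hub pair graphs": the vertices come in m + 1 pairs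
-- {(p,0),(p,1)}; the two vertices of a pair are joined by a blue and a red
-- edge, and every vertex of the hub pair 0 is joined in blue to every other
-- vertex.  Red edges therefore only join partners, and blue edges between
-- different pairs always touch the hub.
--
-- Then, for the hub
-- pair graph, 2-NM-closure is immediate, the pairs are digons forming a
-- cycle factor, colour-connectivity comes from one explicit blue-to-red path
-- between vertices of different pairs together with its reverse, and there
-- is no alternating path with six edges: it contains a stretch coloured
-- blue, red, blue, red, blue, whose red edges join partners, so the pairs it
-- meets would form a path with three edges in the star of pairs around the
-- hub.  A Hamiltonian cycle on at least 8 vertices would contain such a
-- path; the graphs with 4 + i pairs, which are non-isomorphic because their
-- orders differ, prove the theorem.

open import Defs
open import Data.Nat using (ℕ; zero; suc; _≤_; _<_; _∸_; _+_; _*_; z≤n; s≤s; _≤?_; _<?_)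
import Data.Nat.Properties as ℕ
open import Data.Fin using (Fin; combine; remQuot; fromℕ<) renaming (zero to 0F; suc to sucF)
import Data.Fin.Properties as Fin
open import Data.Fin.Permutation using (↔⇒≡)
open import Data.Product using (Σ; _×_; _,_; proj₁; proj₂; ∃-syntax)
open import Data.Sum using (_⊎_; inj₁; inj₂)
open import Data.Empty using (⊥; ⊥-elim)
open import Data.Bool.Properties using (T-≡)
open import Function.Bundles using (Equivalence; mk⇔)
open import Relation.Binary.PropositionalEquality as ≡
  using (_≡_; _≢_; refl; trans; cong; cong₂; subst; ≢-sym)
open import Relation.Nullary using (¬_; Dec; yes; no; does; ¬?)
open import Relation.Nullary.Decidable using (_×-dec_; _⊎-dec_; dec-true; dec-false; isYes≗does; does-⇔; toWitness; True)

flip : Color → Color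
flip blue = red
flip red  = blue

≢⇒flip : ∀ {c d} → c ≢ d → d ≡ flip c
≢⇒flip {blue} {blue} c≢d = ⊥-elim (c≢d refl)
≢⇒flip {blue} {red}  _   = refl
≢⇒flip {red}  {blue} _   = refl
≢⇒flip {red}  {red}  c≢d = ⊥-elim (c≢d refl)

altColour : Color → ℕ → Color
altColour c zero    = c
altColour c (suc i) = flip (altColour c i)

_◂_ : {A : Set} → A → (ℕ → A) → ℕ → A
(a ◂ f) zero    = a
(a ◂ f) (suc i) = f i

∸-step : ∀ {i k} → i < k → suc (k ∸ suc i) ≡ k ∸ i
∸-step {i} {k} i<k = ≡.sym (ℕ.+-∸-assoc 1 i<k)

∸-suc< : ∀ {i k} → i < k → k ∸ suc i < k
∸-suc< {i} {k} i<k = subst (_≤ k) (≡.sym (∸-step i<k)) (ℕ.m∸n≤m k i)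

Vertex : Graph2 → Set
Vertex G = Fin (n G)

E-sym : ∀ {G c} {x y : Vertex G} → E G c x y → E G c y x
E-sym {G} {c} {x} {y} e = trans (sym G c y x) e

module _ {G : Graph2} where

  alternation : ∀ {x y} (P : AltPath G x y) (i : ℕ) → i < AltPath.len P →
                AltPath.col P i ≡ altColour (firstColor P) i
  alternation P zero    _     = refl
  alternation P (suc i) i+1<l =
    trans (≢⇒flip (AltPath.alt P i i+1<l)) (cong flip (alternation P i (ℕ.<⇒≤ i+1<l)))

  single : ∀ c {x y : Vertex G} → x ≢ y → E G c x y → AltPath G x y
  single c {x} {y} x≢y e = record
    { len = 1 ; len≥1 = s≤s z≤n ; v = ends ; col = λ _ → c
    ; start = refl ; end = refl ; edges = edges ; alt = λ { _ (s≤s ()) }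
    ; distinct = distinct }
    where
    ends : ℕ → Vertex G
    ends zero    = x
    ends (suc _) = y
    edges : ∀ i → i < 1 → E G c (ends i) (ends (suc i))
    edges zero    _        = e
    edges (suc _) (s≤s ())
    distinct : ∀ i j → i ≤ 1 → j ≤ 1 → ends i ≡ ends j → i ≡ j
    distinct zero          zero          _              _              _   = refl
    distinct zero          (suc zero)    _              _              x≡y = ⊥-elim (x≢y x≡y)
    distinct (suc zero)    zero          _              _              y≡x = ⊥-elim (x≢y (≡.sym y≡x))
    distinct (suc zero)    (suc zero)    _              _              _   = refl
    distinct (suc (suc _)) _             (s≤s ())       _              _
    distinct _             (suc (suc _)) _              (s≤s ())       _

  -- The path P does not visit z (a record, so that P can be recovered by unification).
  record Avoids {x y : Vertex G} (P : AltPath G x y) (z : Vertex G) : Set where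
    constructor avoiding
    field misses : ∀ i → i ≤ AltPath.len P → AltPath.v P i ≢ z
  open Avoids

  avoids-single : ∀ {c} {x y z : Vertex G} {x≢y : x ≢ y} {e : E G c x y} →
                  x ≢ z → y ≢ z → Avoids (single c x≢y e) z
  avoids-single x≢z y≢z = avoiding λ where
    zero          _        → x≢z
    (suc zero)    _        → y≢z
    (suc (suc _)) (s≤s ())

  cons : ∀ c {x y z : Vertex G} (P : AltPath G y z) →
         E G c x y → c ≢ firstColor P → Avoids P x → AltPath G x z
  cons c {x} P e c≢first avoids = record
    { len = suc len ; len≥1 = s≤s z≤n ; v = x ◂ v ; col = c ◂ col
    ; start = refl ; end = end ; edges = edges′ ; alt = alt′ ; distinct = distinct′ }
    where
    open AltPath P
    edges′ : ∀ i → i < suc len → E G ((c ◂ col) i) ((x ◂ v) i) ((x ◂ v) (suc i))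
    edges′ zero    _           = subst (E G c x) (≡.sym start) e
    edges′ (suc i) (s≤s i<len) = edges i i<len
    alt′ : ∀ i → suc i < suc len → (c ◂ col) i ≢ (c ◂ col) (suc i)
    alt′ zero    _               = c≢first
    alt′ (suc i) (s≤s i+1<len)   = alt i i+1<len
    distinct′ : ∀ i j → i ≤ suc len → j ≤ suc len → (x ◂ v) i ≡ (x ◂ v) j → i ≡ j
    distinct′ zero    zero    _         _         _ = refl
    distinct′ zero    (suc j) _         (s≤s j≤l) x≡vj = ⊥-elim (misses avoids j j≤l (≡.sym x≡vj))
    distinct′ (suc i) zero    (s≤s i≤l) _         vi≡x = ⊥-elim (misses avoids i i≤l vi≡x)
    distinct′ (suc i) (suc j) (s≤s i≤l) (s≤s j≤l) vi≡vj = cong suc (distinct i j i≤l j≤l vi≡vj)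

  avoids-cons : ∀ {c} {x y z w : Vertex G} {P : AltPath G y z} {e : E G c x y}
                {c≢first : c ≢ firstColor P} {avoids : Avoids P x} →
                x ≢ w → Avoids P w → Avoids (cons c P e c≢first avoids) w
  avoids-cons x≢w avoidsP = avoiding λ where
    zero    _         → x≢w
    (suc i) (s≤s i≤l) → misses avoidsP i i≤l

  reverse : ∀ {x y : Vertex G} → AltPath G x y → AltPath G y x
  reverse P = record
    { len = len ; len≥1 = len≥1 ; v = λ i → v (len ∸ i) ; col = λ i → col (len ∸ suc i)
    ; start = end ; end = trans (cong v (ℕ.n∸n≡0 len)) start
    ; edges = edges′ ; alt = alt′ ; distinct = distinct′ }
    where
    open AltPath P
    edges′ : ∀ i → i < len → E G (col (len ∸ suc i)) (v (len ∸ i)) (v (len ∸ suc i))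
    edges′ i i<len = E-sym {G} (subst (λ k → E G (col (len ∸ suc i)) (v (len ∸ suc i)) (v k))
                                  (∸-step i<len) (edges (len ∸ suc i) (∸-suc< i<len)))
    alt′ : ∀ i → suc i < len → col (len ∸ suc i) ≢ col (len ∸ suc (suc i))
    alt′ i i+1<len same = alt (len ∸ suc (suc i)) next (≡.sym (trans (cong col (∸-step i+1<len)) same))
      where
      next : suc (len ∸ suc (suc i)) < len
      next = subst (_< len) (≡.sym (∸-step i+1<len)) (∸-suc< (ℕ.<⇒≤ i+1<len))
    distinct′ : ∀ i j → i ≤ len → j ≤ len → v (len ∸ i) ≡ v (len ∸ j) → i ≡ j
    distinct′ i j i≤l j≤l same =
      ℕ.∸-cancelˡ-≡ i≤l j≤l (distinct (len ∸ i) (len ∸ j) (ℕ.m∸n≤m len i) (ℕ.m∸n≤m len j) same)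

  lastColor-reverse : ∀ {x y : Vertex G} (P : AltPath G x y) → lastColor (reverse P) ≡ firstColor P
  lastColor-reverse P = cong col (trans (cong (len ∸_) (∸-step len≥1)) (ℕ.n∸n≡0 len))
    where open AltPath P

  dropFirst : ∀ {x y : Vertex G} (P : AltPath G x y) → 2 ≤ AltPath.len P →
              AltPath G (AltPath.v P 1) y
  dropFirst P 2≤len = record
    { len = len ∸ 1 ; len≥1 = ℕ.∸-monoˡ-≤ 1 2≤len ; v = λ i → v (suc i) ; col = λ i → col (suc i)
    ; start = refl ; end = trans (cong v (∸-step len≥1)) end
    ; edges = λ i i<l → edges (suc i) (shift i<l)
    ; alt = λ i i+1<l → alt (suc i) (shift i+1<l)
    ; distinct = λ i j i≤l j≤l same → ℕ.suc-injective (distinct (suc i) (suc j) (shift i≤l) (shift j≤l) same) }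
    where
    open AltPath P
    shift : ∀ {i} → i ≤ len ∸ 1 → suc i ≤ len
    shift i≤l = subst (_ ≤_) (∸-step len≥1) (s≤s i≤l)

  prefix : (C : AltCycle G) (k : ℕ) → 1 ≤ k → k < AltCycle.len C →
           AltPath G (AltCycle.v C 0) (AltCycle.v C k)
  prefix C k 1≤k k<len = record
    { len = k ; len≥1 = 1≤k ; v = v ; col = col ; start = refl ; end = refl
    ; edges = λ i i<k → edges i (ℕ.<-trans i<k k<len)
    ; alt = λ i i+1<k → alt i (ℕ.<-trans i+1<k k<len)
    ; distinct = λ i j i≤k j≤k → distinct i j (ℕ.≤-<-trans i≤k k<len) (ℕ.≤-<-trans j≤k k<len) }
    where open AltCycle C

  hamiltonian-length : (C : AltCycle G) → IsHamiltonian C → n G ≤ AltCycle.len C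
  hamiltonian-length C ham = Fin.injective⇒≤ position-injective
    where
    open AltCycle C
    position : Vertex G → Fin len
    position w = fromℕ< (proj₁ (proj₂ (ham w)))
    position-injective : ∀ {w w′} → position w ≡ position w′ → w ≡ w′
    position-injective {w} {w′} same with ham w | ham w′
    ... | i , i<len , vi≡w | j , j<len , vj≡w′ =
      trans (≡.sym vi≡w) (trans (cong v (Fin.fromℕ<-injective i j i<len j<len same)) vj≡w′)

  digon : {x y : Vertex G} → x ≢ y → E G blue x y → E G red x y → AltCycle G
  digon {x} {y} x≢y blue-xy red-xy = record
    { len = 2 ; len≥2 = s≤s (s≤s z≤n) ; v = ends ; col = blue ◂ λ _ → red ; closed = refl
    ; edges = edges ; alt = λ { zero _ () ; (suc _) (s≤s (s≤s ())) } ; altClose = λ ()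
    ; distinct = distinct }
    where
    ends : ℕ → Vertex G
    ends 1 = y
    ends _ = x
    edges : ∀ i → i < 2 → E G ((blue ◂ λ _ → red) i) (ends i) (ends (suc i))
    edges zero       _ = blue-xy
    edges (suc zero) _ = E-sym {G} red-xy
    edges (suc (suc _)) (s≤s (s≤s ()))
    distinct : ∀ i j → i < 2 → j < 2 → ends i ≡ ends j → i ≡ j
    distinct zero          zero          _               _               _   = refl
    distinct zero          (suc zero)    _               _               x≡y = ⊥-elim (x≢y x≡y)
    distinct (suc zero)    zero          _               _               y≡x = ⊥-elim (x≢y (≡.sym y≡x))
    distinct (suc zero)    (suc zero)    _               _               _   = refl
    distinct (suc (suc _)) _             (s≤s (s≤s ()))  _               _
    distinct _             (suc (suc _)) _               (s≤s (s≤s ()))  _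

  on-digon : ∀ {x y w : Vertex G} (x≢y : x ≢ y) (b : E G blue x y) (r : E G red x y) →
             OnCycle (digon x≢y b r) w → w ≡ x ⊎ w ≡ y
  on-digon _ _ _ (zero        , _              , x≡w) = inj₁ (≡.sym x≡w)
  on-digon _ _ _ (suc zero    , _              , y≡w) = inj₂ (≡.sym y≡w)
  on-digon _ _ _ (suc (suc _) , s≤s (s≤s ())   , _)

isomorphic⇒same-order : ∀ {G H} → Isomorphic G H → n G ≡ n H
isomorphic⇒same-order (f , _) = ↔⇒≡ f

other : Fin 2 → Fin 2
other 0F        = sucF 0F
other (sucF 0F) = 0F

other≢ : ∀ s → other s ≢ s
other≢ 0F        ()
other≢ (sucF 0F) ()

two-sides : (a b c : Fin 2) → a ≢ b → c ≡ a ⊎ c ≡ b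
two-sides 0F        0F        _         a≢b = ⊥-elim (a≢b refl)
two-sides (sucF 0F) (sucF 0F) _         a≢b = ⊥-elim (a≢b refl)
two-sides 0F        (sucF 0F) 0F        _   = inj₁ refl
two-sides 0F        (sucF 0F) (sucF 0F) _   = inj₂ refl
two-sides (sucF 0F) 0F        0F        _   = inj₂ refl
two-sides (sucF 0F) 0F        (sucF 0F) _   = inj₁ refl

-- The hub pair graph with m + 1 pairs: vertex (p , s) of Fin (m + 1) × Fin 2
-- is encoded as an element of Fin ((m + 1) * 2) via combine/remQuot.
module HubPairGraph (m : ℕ) where

  Pair : Set
  Pair = Fin (suc m)

  hub : Pair
  hub = 0F

  V : Set
  V = Fin (suc m * 2)

  vertex : Pair → Fin 2 → V
  vertex = combine

  pair : V → Pair
  pair x = proj₁ (remQuot {suc m} 2 x)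

  side : V → Fin 2
  side x = proj₂ (remQuot {suc m} 2 x)

  pair-vertex : ∀ p s → pair (vertex p s) ≡ p
  pair-vertex p s = cong proj₁ (Fin.remQuot-combine p s)

  side-vertex : ∀ p s → side (vertex p s) ≡ s
  side-vertex p s = cong proj₂ (Fin.remQuot-combine p s)

  pair-side-injective : ∀ {x y} → pair x ≡ pair y → side x ≡ side y → x ≡ y
  pair-side-injective {x} {y} px≡py sx≡sy = begin
    x                        ≡⟨ ≡.sym (Fin.combine-remQuot {suc m} 2 x) ⟩
    vertex (pair x) (side x) ≡⟨ cong₂ vertex px≡py sx≡sy ⟩
    vertex (pair y) (side y) ≡⟨ Fin.combine-remQuot {suc m} 2 y ⟩
    y                        ∎
    where open ≡.≡-Reasoning

  apart : ∀ {x y} → pair x ≢ pair y → x ≢ y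
  apart px≢py x≡y = px≢py (cong pair x≡y)

  pair-excludes : ∀ {a b c} → a ≢ c → b ≢ c → a ≢ b → pair b ≡ pair c → pair a ≢ pair c
  pair-excludes {a} {b} {c} a≢c b≢c a≢b pb≡pc pa≡pc
    with two-sides (side b) (side c) (side a) (λ sb≡sc → b≢c (pair-side-injective pb≡pc sb≡sc))
  ... | inj₁ sa≡sb = a≢b (pair-side-injective (trans pa≡pc (≡.sym pb≡pc)) sa≡sb)
  ... | inj₂ sa≡sc = a≢c (pair-side-injective pa≡pc sa≡sc)

  partner : V → V
  partner x = vertex (pair x) (other (side x))

  pair-partner : ∀ x → pair (partner x) ≡ pair x
  pair-partner x = pair-vertex (pair x) (other (side x))

  partner≢ : ∀ x → partner x ≢ x
  partner≢ x px≡x =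
    other≢ (side x) (trans (≡.sym (side-vertex (pair x) (other (side x)))) (cong side px≡x))

  Linked : Pair → Pair → Set
  Linked p q = p ≡ q ⊎ (p ≡ hub ⊎ q ≡ hub)

  Joined : Color → Pair → Pair → Set
  Joined red  p q = p ≡ q
  Joined blue p q = Linked p q

  joined? : ∀ c p q → Dec (Joined c p q)
  joined? red  p q = p Fin.≟ q
  joined? blue p q = (p Fin.≟ q) ⊎-dec ((p Fin.≟ hub) ⊎-dec (q Fin.≟ hub))

  joined-sym : ∀ c {p q} → Joined c p q → Joined c q p
  joined-sym red  p≡q                = ≡.sym p≡q
  joined-sym blue (inj₁ p≡q)         = inj₁ (≡.sym p≡q)
  joined-sym blue (inj₂ (inj₁ p≡h))  = inj₂ (inj₂ p≡h)
  joined-sym blue (inj₂ (inj₂ q≡h))  = inj₂ (inj₁ q≡h)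

  Adjacent : Color → V → V → Set
  Adjacent c x y = x ≢ y × Joined c (pair x) (pair y)

  adjacent? : ∀ c x y → Dec (Adjacent c x y)
  adjacent? c x y = ¬? (x Fin.≟ y) ×-dec joined? c (pair x) (pair y)

  adjacent-sym : ∀ {c x y} → Adjacent c x y → Adjacent c y x
  adjacent-sym {c} (x≢y , joined) = ≢-sym x≢y , joined-sym c joined

  G : Graph2
  G = record
    { n      = suc m * 2
    ; edge   = λ c x y → does (adjacent? c x y)
    ; sym    = λ c x y → does-⇔ (mk⇔ adjacent-sym adjacent-sym) (adjacent? c x y) (adjacent? c y x)
    ; irrefl = λ c x → dec-false (adjacent? c x x) (λ adj → proj₁ adj refl) }

  edge-of : ∀ c x y → Adjacent c x y → E G c x y
  edge-of c x y = dec-true (adjacent? c x y)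

  adjacency : ∀ c x y → E G c x y → Adjacent c x y
  adjacency c x y e =
    toWitness (Equivalence.from T-≡ (trans (isYes≗does (adjacent? c x y)) e))

  -- 2-NM-closure: a red edge followed by a blue one (or conversely) passes
  -- through a partner, so the outer vertices have linked pairs.
  twoNMClosed : TwoNMClosed G
  twoNMClosed x₁ x₂ x₃ blue blue _ _ _ c₁≢c₂ = ⊥-elim (c₁≢c₂ refl)
  twoNMClosed x₁ x₂ x₃ red  red  _ _ _ c₁≢c₂ = ⊥-elim (c₁≢c₂ refl)
  twoNMClosed x₁ x₂ x₃ red blue x₁≢x₃ e₁ e₂ _ = blue , edge-of blue x₁ x₃ (x₁≢x₃ , linked)
    where
    linked : Linked (pair x₁) (pair x₃)
    linked = subst (λ p → Linked p (pair x₃)) (≡.sym (proj₂ (adjacency red x₁ x₂ e₁)))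
                   (proj₂ (adjacency blue x₂ x₃ e₂))
  twoNMClosed x₁ x₂ x₃ blue red x₁≢x₃ e₁ e₂ _ = blue , edge-of blue x₁ x₃ (x₁≢x₃ , linked)
    where
    linked : Linked (pair x₁) (pair x₃)
    linked = subst (Linked (pair x₁)) (proj₂ (adjacency red x₂ x₃ e₂)) (proj₂ (adjacency blue x₁ x₂ e₁))

  pair-ends : ∀ p → vertex p 0F ≢ vertex p (sucF 0F)
  pair-ends p same =
    0≢1 (trans (≡.sym (side-vertex p 0F)) (trans (cong side same) (side-vertex p (sucF 0F))))
    where
    0≢1 : 0F ≢ sucF 0F
    0≢1 ()

  same-pair : ∀ p → pair (vertex p 0F) ≡ pair (vertex p (sucF 0F))
  same-pair p = trans (pair-vertex p 0F) (≡.sym (pair-vertex p (sucF 0F)))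

  pair-blue : ∀ p → E G blue (vertex p 0F) (vertex p (sucF 0F))
  pair-blue p = edge-of blue _ _ (pair-ends p , inj₁ (same-pair p))

  pair-red : ∀ p → E G red (vertex p 0F) (vertex p (sucF 0F))
  pair-red p = edge-of red _ _ (pair-ends p , same-pair p)

  pairCycle : Pair → AltCycle G
  pairCycle p = digon (pair-ends p) (pair-blue p) (pair-red p)

  on-pairCycle : ∀ {p w} → OnCycle (pairCycle p) w → pair w ≡ p
  on-pairCycle {p} on with on-digon (pair-ends p) (pair-blue p) (pair-red p) on
  ... | inj₁ w≡left  = trans (cong pair w≡left) (pair-vertex p 0F)
  ... | inj₂ w≡right = trans (cong pair w≡right) (pair-vertex p (sucF 0F))

  cycleFactor : HasAltCycleFactor G
  cycleFactor = suc m , pairCycle , disjoint , covering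
    where
    disjoint : ∀ p q w → OnCycle (pairCycle p) w → OnCycle (pairCycle q) w → p ≡ q
    disjoint p q w on-p on-q = trans (≡.sym (on-pairCycle on-p)) (on-pairCycle on-q)
    at-side : ∀ w s → side w ≡ s → vertex (pair w) s ≡ w
    at-side w s sw≡s =
      pair-side-injective (pair-vertex (pair w) s) (trans (side-vertex (pair w) s) (≡.sym sw≡s))
    covering : ∀ w → ∃[ p ] OnCycle (pairCycle p) w
    covering w with two-sides 0F (sucF 0F) (side w) (λ ())
    ... | inj₁ sw≡0 = pair w , 0 , s≤s z≤n , at-side w 0F sw≡0
    ... | inj₂ sw≡1 = pair w , 1 , s≤s (s≤s z≤n) , at-side w (sucF 0F) sw≡1

  BlueRedPath : V → V → Set
  BlueRedPath x y = Σ (AltPath G x y) λ P → firstColor P ≡ blue × lastColor P ≡ red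

  -- For vertices in different linked pairs: x —blue— partner y —red— y.
  viaPartner : ∀ x y → pair x ≢ pair y → Linked (pair x) (pair y) → AltPath G x y
  viaPartner x y px≢py linked = cons blue last-edge first-edge (λ ()) avoids
    where
    py′≡py : pair (partner y) ≡ pair y
    py′≡py = pair-partner y
    last-edge : AltPath G (partner y) y
    last-edge = single red (partner≢ y) (edge-of red (partner y) y (partner≢ y , py′≡py))
    first-edge : E G blue x (partner y)
    first-edge = edge-of blue x (partner y)
                   (apart (λ px≡py′ → px≢py (trans px≡py′ py′≡py)) , subst (Linked (pair x)) (≡.sym py′≡py) linked)
    avoids : Avoids last-edge x
    avoids = avoids-single (apart (λ py′≡px → px≢py (≡.sym (trans (≡.sym py′≡py) py′≡px)))) (apart (≢-sym px≢py))

  viaPartner-avoids : ∀ {x y z} (px≢py : pair x ≢ pair y) (linked : Linked (pair x) (pair y)) →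
                      x ≢ z → pair y ≢ pair z → Avoids (viaPartner x y px≢py linked) z
  viaPartner-avoids {y = y} _ _ x≢z py≢pz =
    avoids-cons x≢z (avoids-single (apart (λ py′≡pz → py≢pz (trans (≡.sym (pair-partner y)) py′≡pz))) (apart py≢pz))

  viaPartner-blueRed : ∀ {x y} (px≢py : pair x ≢ pair y) (linked : Linked (pair x) (pair y)) → BlueRedPath x y
  viaPartner-blueRed px≢py linked = viaPartner _ _ px≢py linked , refl , refl

  -- For vertices outside the hub: x —blue— (hub,0) —red— (hub,1) —blue— partner y —red— y.
  throughHub : ∀ {x y} → pair x ≢ pair y → pair x ≢ hub → pair y ≢ hub → BlueRedPath x y
  throughHub {x} {y} px≢py px≢hub py≢hub = path , refl , refl
    where
    u₀ u₁ : V
    u₀ = vertex hub 0F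
    u₁ = vertex hub (sucF 0F)
    hub≢py : pair u₁ ≢ pair y
    hub≢py pu₁≡py = py≢hub (trans (≡.sym pu₁≡py) (pair-vertex hub (sucF 0F)))
    x≢hub : ∀ s → x ≢ vertex hub s
    x≢hub s = apart (λ px≡pu → px≢hub (trans px≡pu (pair-vertex hub s)))
    tail : AltPath G u₁ y
    tail = viaPartner u₁ y hub≢py (inj₂ (inj₁ (pair-vertex hub (sucF 0F))))
    py≢hub₀ : pair y ≢ pair u₀
    py≢hub₀ py≡pu₀ = py≢hub (trans py≡pu₀ (pair-vertex hub 0F))
    middle : AltPath G u₀ y
    middle = cons red tail (edge-of red u₀ u₁ (pair-ends hub , same-pair hub)) (λ ())
                  (viaPartner-avoids hub≢py _ (≢-sym (pair-ends hub)) py≢hub₀)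
    path : AltPath G x y
    path = cons blue middle (edge-of blue x u₀ (x≢hub 0F , inj₂ (inj₂ (pair-vertex hub 0F)))) (λ ())
                (avoids-cons (≢-sym (x≢hub 0F)) (viaPartner-avoids hub≢py _ (≢-sym (x≢hub (sucF 0F))) (≢-sym px≢py)))

  blueRedPath : ∀ {x y} → pair x ≢ pair y → BlueRedPath x y
  blueRedPath {x} {y} px≢py with pair x Fin.≟ hub | pair y Fin.≟ hub
  ... | yes px≡hub | _          = viaPartner-blueRed px≢py (inj₂ (inj₁ px≡hub))
  ... | no _       | yes py≡hub = viaPartner-blueRed px≢py (inj₂ (inj₂ py≡hub))
  ... | no px≢hub  | no py≢hub  = throughHub px≢py px≢hub py≢hub

  -- Same pair: the blue and the red edge.  Different pairs: a blue-to-red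
  -- path from x to y and the reverse of one from y to x.
  colorConnected : ColorConnected G
  colorConnected x y x≢y with pair x Fin.≟ pair y
  ... | yes px≡py = single blue x≢y (edge-of blue x y (x≢y , inj₁ px≡py))
                  , single red x≢y (edge-of red x y (x≢y , px≡py)) , (λ ()) , (λ ())
  ... | no px≢py with blueRedPath px≢py | blueRedPath (≢-sym px≢py)
  ...   | P , P-first , P-last | Q , Q-first , Q-last =
    P , reverse Q , opposite P-first Q-last , ≢-sym (opposite (trans (lastColor-reverse Q) Q-first) P-last)
    where
    opposite : ∀ {a b} → a ≡ blue → b ≡ red → a ≢ b
    opposite refl refl ()

  touches-hub : ∀ {p q} → p ≢ q → Linked p q → p ≡ hub ⊎ q ≡ hub
  touches-hub p≢q (inj₁ p≡q) = ⊥-elim (p≢q p≡q)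
  touches-hub _   (inj₂ at-hub) = at-hub

  -- The linked pairs form a star around the hub, which has no path with three edges.
  star-has-no-P₄ : ∀ {p₀ p₁ p₂ p₃} → p₀ ≢ p₁ → p₁ ≢ p₂ → p₂ ≢ p₃ → p₀ ≢ p₂ → p₁ ≢ p₃ →
                   Linked p₀ p₁ → Linked p₁ p₂ → Linked p₂ p₃ → ⊥
  star-has-no-P₄ p₀≢p₁ p₁≢p₂ p₂≢p₃ p₀≢p₂ p₁≢p₃ l₀₁ l₁₂ l₂₃ with touches-hub p₁≢p₂ l₁₂
  ... | inj₁ p₁≡hub with touches-hub p₂≢p₃ l₂₃
  ...   | inj₁ p₂≡hub = p₁≢p₂ (trans p₁≡hub (≡.sym p₂≡hub))
  ...   | inj₂ p₃≡hub = p₁≢p₃ (trans p₁≡hub (≡.sym p₃≡hub))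
  star-has-no-P₄ p₀≢p₁ p₁≢p₂ p₂≢p₃ p₀≢p₂ p₁≢p₃ l₀₁ l₁₂ l₂₃ | inj₂ p₂≡hub with touches-hub p₀≢p₁ l₀₁
  ...   | inj₁ p₀≡hub = p₀≢p₂ (trans p₀≡hub (≡.sym p₂≡hub))
  ...   | inj₂ p₁≡hub = p₁≢p₂ (trans p₁≡hub (≡.sym p₂≡hub))

  -- An alternating path starting in blue has at most four edges: its red
  -- edges 1 and 3 join partners, so the pairs of vertices 0, 2, 4, 5 would
  -- form a path with three edges in the star (pair v1 = pair v2, pair v3 = pair v4,
  -- and no third vertex of the path lies in either of these two pairs).
  blue-paths-are-short : ∀ {x y} (P : AltPath G x y) → firstColor P ≡ blue → 5 ≤ AltPath.len P → ⊥
  blue-paths-are-short P first≡blue 5≤len =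
    star-has-no-P₄
      (pair-excludes (apart-at 0 2 (λ ())) (apart-at 1 2 (λ ())) (apart-at 0 1 (λ ())) (joined-at 1))
      (pair-excludes (apart-at 2 4 (λ ())) (apart-at 3 4 (λ ())) (apart-at 2 3 (λ ())) (joined-at 3))
      (≢-sym (pair-excludes (apart-at 5 4 (λ ())) (apart-at 3 4 (λ ())) (apart-at 5 3 (λ ())) (joined-at 3)))
      (pair-excludes (apart-at 0 4 (λ ())) (apart-at 3 4 (λ ())) (apart-at 0 3 (λ ())) (joined-at 3))
      (≢-sym (pair-excludes (apart-at 5 2 (λ ())) (apart-at 1 2 (λ ())) (apart-at 5 1 (λ ())) (joined-at 1)))
      (subst (Linked (pair (v 0))) (joined-at 1) (joined-at 0))
      (subst (Linked (pair (v 2))) (joined-at 3) (joined-at 2))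
      (joined-at 4)
    where
    open AltPath P
    joined-at : ∀ i {i<5 : True (i <? 5)} → Joined (altColour blue i) (pair (v i)) (pair (v (suc i)))
    joined-at i {i<5} = proj₂ (adjacency (altColour blue i) (v i) (v (suc i)) edge-i)
      where
      i<len : i < len
      i<len = ℕ.<-≤-trans (toWitness i<5) 5≤len
      colour : col i ≡ altColour blue i
      colour = trans (alternation P i i<len) (cong (λ c → altColour c i) first≡blue)
      edge-i : E G (altColour blue i) (v i) (v (suc i))
      edge-i = subst (λ c → E G c (v i) (v (suc i))) colour (edges i i<len)
    apart-at : ∀ i j {i≤5 : True (i ≤? 5)} {j≤5 : True (j ≤? 5)} → i ≢ j → v i ≢ v j
    apart-at i j {i≤5} {j≤5} i≢j vi≡vj =
      i≢j (distinct i j (ℕ.≤-trans (toWitness i≤5) 5≤len) (ℕ.≤-trans (toWitness j≤5) 5≤len) vi≡vj)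

  -- Hence no alternating path has six edges: if it starts in red, drop the first edge.
  no-long-paths : ∀ {x y} (P : AltPath G x y) → 6 ≤ AltPath.len P → ⊥
  no-long-paths P 6≤len with firstColor P in first
  ... | blue = blue-paths-are-short P first (ℕ.<⇒≤ 6≤len)
  ... | red  = blue-paths-are-short (dropFirst P 2≤len) second (ℕ.∸-monoˡ-≤ 1 6≤len)
    where
    2≤len : 2 ≤ AltPath.len P
    2≤len = ℕ.≤-trans (s≤s (s≤s z≤n)) 6≤len
    second : AltPath.col P 1 ≡ blue
    second = trans (≢⇒flip (AltPath.alt P 0 2≤len)) (cong flip first)

  -- With at least four pairs a Hamiltonian cycle has at least 8 > 6 edges.
  noHamiltonianCycle : 3 ≤ m → ¬ HasAltHamCycle G
  noHamiltonianCycle 3≤m (C , ham) = no-long-paths (prefix C 6 (s≤s z≤n) 6<len) ℕ.≤-refl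
    where
    6<len : 6 < AltCycle.len C
    6<len = ℕ.<⇒≤ (ℕ.≤-trans (ℕ.*-monoˡ-≤ 2 (s≤s 3≤m)) (hamiltonian-length C ham))

family : ℕ → Graph2
family i = HubPairGraph.G (3 + i)

non-isomorphic : ∀ i j → i ≢ j → ¬ Isomorphic (family i) (family j)
non-isomorphic i j i≢j iso =
  i≢j (ℕ.+-cancelˡ-≡ 4 i j (ℕ.*-cancelʳ-≡ (4 + i) (4 + j) 2 (isomorphic⇒same-order {family i} {family j} iso)))

mainTheorem5 : Σ (ℕ → Graph2) λ F →
    (∀ i → TwoNMClosed (F i) × ColorConnected (F i)
           × HasAltCycleFactor (F i) × ¬ HasAltHamCycle (F i))
    × (∀ i j → i ≢ j → ¬ Isomorphic (F i) (F j))
mainTheorem5 = family , properties , non-isomorphic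
  where
  properties : ∀ i → TwoNMClosed (family i) × ColorConnected (family i)
                     × HasAltCycleFactor (family i) × ¬ HasAltHamCycle (family i)
  properties i = twoNMClosed , colorConnected , cycleFactor , noHamiltonianCycle (ℕ.m≤m+n 3 i)
    where open HubPairGraph (3 + i)
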